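{- There is a constant $c>0$ such that for every $k\in\mathbb N$ and for arbitrarily large $n$ there exists a partial Boolean function $f:S\to\{0,1\}$ with $S\subseteq\{0,1\}^n$ such that $\mathrm{bs}(f)=k$ and $\mathrm{fbs}(f)\ge c\sqrt{n\cdot\mathrm{bs}(f)}$.
   Context: For $x\in S$, $x_i$ is its $i$-th bit. A set $B\subseteq[n]$ is a sensitive block of $x\in S$ if there is $y\in S$ with $f(y)\neq f(x)$ and $B=\{i:x_i\neq y_i\}$. $\mathrm{bs}(f,x)$ is the maximum number of pairwise disjoint sensitive blocks of $x$; $\mathrm{bs}(f)=\max_x\mathrm{bs}(f,x)$. $\mathrm{fbs}(f,x)$ is the maximum of $\sum_Bw(B)$ over weights $w(B)\in[0,1]$ on the sensitive blocks of $x$ with $\sum_{B\ni i}w(B)\le1$ for every $i\in[n]$; $\mathrm{fbs}(f)=\max_x\mathrm{fbs}(f,x)$. -}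

module Defs where

open import Data.Nat using (ℕ; zero; suc)
open import Data.Integer using (+_)
open import Data.Bool using (Bool; true; false; _xor_; _∧_)
open import Data.Maybe using (Maybe; just)
open import Data.Vec using (Vec; []; _∷_; zipWith; lookup)
open import Data.Fin using (Fin)
open import Data.List using (List; []; _∷_; map; _++_; foldr; filterᵇ)
open import Data.Product using (Σ; _×_; ∃)
open import Data.Rational using (ℚ; _+_; _*_; _≤_; _/_; 0ℚ; 1ℚ)
open import Relation.Binary.PropositionalEquality using (_≡_; _≢_)

Cube : ℕ → Set
Cube n = Vec Bool n

-- A partial Boolean function f : S → {0,1} with S ⊆ {0,1}^n;
-- S = { x | f x ≡ just _ }.
PartialFn : ℕ → Set
PartialFn n = Cube n → Maybe Bool

InDom : ∀ {n} → PartialFn n → Cube n → Set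
InDom f x = Σ Bool λ a → f x ≡ just a

-- Subsets B ⊆ [n] as characteristic vectors.
Block : ℕ → Set
Block n = Vec Bool n

SensitiveBlock : ∀ {n} → PartialFn n → Cube n → Block n → Set
SensitiveBlock {n} f x B =
  Σ (Cube n) λ y → Σ Bool λ a → Σ Bool λ b →
    (f x ≡ just a) × (f y ≡ just b) × (a ≢ b) × (B ≡ zipWith _xor_ x y)

Disjoint : ∀ {n} → Block n → Block n → Set
Disjoint {n} B C = ∀ (i : Fin n) → lookup B i ∧ lookup C i ≡ false

DisjointSensitiveFamily : ∀ {n} → PartialFn n → Cube n → (m : ℕ) → Vec (Block n) m → Set
DisjointSensitiveFamily {n} f x m Bs =
  (∀ (j : Fin m) → SensitiveBlock f x (lookup Bs j)) ×
  (∀ (j j' : Fin m) → j ≢ j' → Disjoint (lookup Bs j) (lookup Bs j'))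

BsEq : ∀ {n} → PartialFn n → ℕ → Set
BsEq {n} f k =
  (Σ (Cube n) λ x → InDom f x × Σ (Vec (Block n) k) λ Bs → DisjointSensitiveFamily f x k Bs) ×
  (∀ (x : Cube n) → InDom f x → ∀ (m : ℕ) (Bs : Vec (Block n) m) →
     DisjointSensitiveFamily f x m Bs → m Data.Nat.≤ k)

allBlocks : (n : ℕ) → List (Block n)
allBlocks zero = [] ∷ []
allBlocks (suc n) = map (true ∷_) (allBlocks n) ++ map (false ∷_) (allBlocks n)

sumℚ : List ℚ → ℚ
sumℚ = foldr _+_ 0ℚ

ℕtoℚ : ℕ → ℚ
ℕtoℚ n = (+ n) / 1

-- A feasible fractional weighting of the sensitive blocks of x
-- (weights are given on all subsets; non-sensitive blocks must get weight 0).
FeasibleWeights : ∀ {n} → PartialFn n → Cube n → (Block n → ℚ) → Set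
FeasibleWeights {n} f x w =
  (∀ B → 0ℚ ≤ w B) × (∀ B → w B ≤ 1ℚ) ×
  (∀ B → w B ≢ 0ℚ → SensitiveBlock f x B) ×
  (∀ (i : Fin n) → sumℚ (map w (filterᵇ (λ B → lookup B i) (allBlocks n))) ≤ 1ℚ)

totalWeight : ∀ {n} → (Block n → ℚ) → ℚ
totalWeight {n} w = sumℚ (map w (allBlocks n))

-- fbs(f) ≥ t  (the LP maximum is attained, and at a rational point,
-- so this says: some x ∈ S has a feasible weighting of total ≥ t).
FbsAtLeast : ∀ {n} → PartialFn n → ℚ → Set
FbsAtLeast {n} f t =
  Σ (Cube n) λ x → InDom f x × Σ (Block n → ℚ) λ w → FeasibleWeights f x w × (t ≤ totalWeight w)

-- Split the n = k·m² coordinates into k disjoint m × m grids, and call the union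
-- of a row and a column of one grid a cross. Let f be 0 on the all-zero input and
-- 1 on the indicator vectors of the crosses. Two crosses of the same grid always
-- meet, so disjoint sensitive blocks of the zero input lie in distinct grids and
-- bs(f) = k, while a cross has itself as its only sensitive block. Every
-- coordinate lies on at most 2m of the k·m² crosses, so weight 1/(2m) on each
-- cross is a feasible fractional packing and fbs(f) ≥ km/2 = ½·√(n·k).
-- For k = 0 a constant function works.

module Submission where

open import Defs
open import Data.Nat using (ℕ; _≥_)
open import Data.Product using (Σ; _×_)
open import Data.Rational using (ℚ; _<_; _≤_; _*_; 0ℚ)

import Data.Nat as ℕ
import Data.Nat.Properties as ℕₚ
open import Data.Nat using (zero; suc; z≤n; s≤s)
open import Data.Nat.ListAction using (sum)
open import Data.Nat.ListAction.Properties using (sum-++)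
import Data.Nat.Coprimality as Coprimality
open import Data.Integer using (+_)
import Data.Integer.Properties as ℤₚ
import Data.Rational as ℚ
open import Data.Rational using (1ℚ; ½; mkℚ; _/_; 1/_; Positive; NonNegative; nonNegative)
open import Data.Rational.Solver using (module +-*-Solver)
open +-*-Solver using (solve; _:=_; _:+_; _:*_; con)
import Data.Rational.Properties as ℚₚ
open import Data.Bool using (Bool; true; false; _∧_; _∨_; _xor_)
import Data.Bool.Properties as Boolₚ
open import Data.Fin using (Fin; zero; suc; _↑ˡ_; _↑ʳ_; combine; remQuot)
import Data.Fin.Properties as Finₚ
open import Data.Vec using (Vec; []; _∷_; lookup; zipWith; tabulate; replicate)
open import Data.Vec.Properties using (≡-dec; lookup∘tabulate; lookup-replicate)
import Data.Vec.Properties as Vecₚ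
open import Data.List using (List; []; _∷_; map; _++_; filterᵇ)
open import Data.List.Properties using (map-++; map-∘; map-cong)
open import Data.Product using (_,_; ∃; proj₁; proj₂; map₂)
open import Data.Sum using (_⊎_; inj₁; inj₂)
open import Data.Empty using (⊥; ⊥-elim)
open import Data.Maybe using (just; nothing)
open import Data.Maybe.Properties using (just-injective)
open import Function using (_∘_)
open import Relation.Nullary using (yes; no; does; ¬_)
open import Relation.Nullary.Decidable using (dec-true; dec-false)
open import Relation.Binary.Definitions using (DecidableEquality)
open import Relation.Binary.PropositionalEquality
open import Algebra.Properties.Semiring.Sum ℕₚ.+-*-semiring
  using (sum-syntax; sum-cong-≗; sum-replicate-zero; ∑-distrib-+; ∑-comm; *-distribˡ-sum)

-- The embedding of ℕ into ℚ

ℕtoℚ-homo-+ : ∀ a b → ℕtoℚ (a ℕ.+ b) ≡ ℕtoℚ a ℚ.+ ℕtoℚ b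
ℕtoℚ-homo-+ a b = sym (begin
  ℕtoℚ a ℚ.+ ℕtoℚ b
    ≡⟨ cong₂ ℚ._+_ (as-mkℚ a) (as-mkℚ b) ⟩
  (+ a ℤ.* + 1 ℤ.+ + b ℤ.* + 1) / 1
    ≡⟨ cong (_/ 1) (cong₂ ℤ._+_ (ℤₚ.*-identityʳ (+ a)) (ℤₚ.*-identityʳ (+ b))) ⟩
  ℕtoℚ (a ℕ.+ b)
    ∎)
  where
  import Data.Integer as ℤ
  open ≡-Reasoning
  as-mkℚ : ∀ a → ℕtoℚ a ≡ mkℚ (+ a) 0 (Coprimality.sym (Coprimality.1-coprimeTo a))
  as-mkℚ a = ℚₚ.normalize-coprime (Coprimality.sym (Coprimality.1-coprimeTo a))

ℕtoℚ-homo-* : ∀ a b → ℕtoℚ (a ℕ.* b) ≡ ℕtoℚ a * ℕtoℚ b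
ℕtoℚ-homo-* zero    b = sym (ℚₚ.*-zeroˡ (ℕtoℚ b))
ℕtoℚ-homo-* (suc a) b = begin
  ℕtoℚ (b ℕ.+ a ℕ.* b)
    ≡⟨ ℕtoℚ-homo-+ b (a ℕ.* b) ⟩
  ℕtoℚ b ℚ.+ ℕtoℚ (a ℕ.* b)
    ≡⟨ cong₂ ℚ._+_ (sym (ℚₚ.*-identityˡ (ℕtoℚ b))) (ℕtoℚ-homo-* a b) ⟩
  1ℚ * ℕtoℚ b ℚ.+ ℕtoℚ a * ℕtoℚ b
    ≡⟨ sym (ℚₚ.*-distribʳ-+ (ℕtoℚ b) 1ℚ (ℕtoℚ a)) ⟩
  (1ℚ ℚ.+ ℕtoℚ a) * ℕtoℚ b
    ≡⟨ cong (_* ℕtoℚ b) (sym (ℕtoℚ-homo-+ 1 a)) ⟩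
  ℕtoℚ (suc a) * ℕtoℚ b
    ∎
  where open ≡-Reasoning

ℕtoℚ-nonNeg : ∀ a → 0ℚ ≤ ℕtoℚ a
ℕtoℚ-nonNeg a = ℚₚ.nonNegative⁻¹ (ℕtoℚ a) {{ℚₚ.normalize-nonNeg a 1}}

ℕtoℚ-mono-≤ : ∀ {a b} → a ℕ.≤ b → ℕtoℚ a ≤ ℕtoℚ b
ℕtoℚ-mono-≤ {a} {b} a≤b = begin
  ℕtoℚ a                    ≡⟨ sym (ℚₚ.+-identityʳ (ℕtoℚ a)) ⟩
  ℕtoℚ a ℚ.+ 0ℚ             ≤⟨ ℚₚ.+-monoʳ-≤ (ℕtoℚ a) (ℕtoℚ-nonNeg (b ℕ.∸ a)) ⟩
  ℕtoℚ a ℚ.+ ℕtoℚ (b ℕ.∸ a) ≡⟨ sym (ℕtoℚ-homo-+ a (b ℕ.∸ a)) ⟩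
  ℕtoℚ (a ℕ.+ (b ℕ.∸ a))    ≡⟨ cong ℕtoℚ (ℕₚ.m+[n∸m]≡n a≤b) ⟩
  ℕtoℚ b                    ∎
  where open ℚₚ.≤-Reasoning

ℕtoℚ-*-nonNeg : ∀ c {α} → 0ℚ ≤ α → 0ℚ ≤ ℕtoℚ c * α
ℕtoℚ-*-nonNeg c {α} α≥0 = ℚₚ.≤-trans (ℚₚ.≤-reflexive (sym (ℚₚ.*-zeroˡ α)))
                                     (ℚₚ.*-monoʳ-≤-nonNeg α {{nonNegative α≥0}} (ℕtoℚ-nonNeg c))

-- Counting with indicators

𝟙 : Bool → ℕ
𝟙 true  = 1
𝟙 false = 0

𝟙-∧-∨-≤ : ∀ a b c → 𝟙 (a ∧ (b ∨ c)) ℕ.≤ 𝟙 a ℕ.* (𝟙 b ℕ.+ 𝟙 c)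
𝟙-∧-∨-≤ false b     c     = z≤n
𝟙-∧-∨-≤ true  true  c     = s≤s z≤n
𝟙-∧-∨-≤ true  false true  = s≤s z≤n
𝟙-∧-∨-≤ true  false false = z≤n

∧-≡-false : ∀ {a b} → (a ≡ true → b ≡ true → ⊥) → a ∧ b ≡ false
∧-≡-false {false}         _     = refl
∧-≡-false {true}  {false} _     = refl
∧-≡-false {true}  {true}  ¬both = ⊥-elim (¬both refl refl)

xor-≢ : ∀ {a b} → a ≢ b → a xor b ≡ true
xor-≢ {false} {false} a≢b = ⊥-elim (a≢b refl)
xor-≢ {false} {true}  _   = refl
xor-≢ {true}  {false} _   = refl
xor-≢ {true}  {true}  a≢b = ⊥-elim (a≢b refl)

∑-zero : ∀ {a} {g : Fin a → ℕ} → (∀ i → g i ≡ 0) → ∑[ i < a ] g i ≡ 0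
∑-zero {a} g≗0 = trans (sum-cong-≗ g≗0) (sum-replicate-zero a)

∑-const : ∀ a c → ∑[ i < a ] c ≡ a ℕ.* c
∑-const zero    c = refl
∑-const (suc a) c = cong (c ℕ.+_) (∑-const a c)

∑-mono-≤ : ∀ {a} {g h : Fin a → ℕ} → (∀ i → g i ℕ.≤ h i) → ∑[ i < a ] g i ℕ.≤ ∑[ i < a ] h i
∑-mono-≤ {zero}  g≤h = z≤n
∑-mono-≤ {suc a} g≤h = ℕₚ.+-mono-≤ (g≤h zero) (∑-mono-≤ (g≤h ∘ suc))

∑-sift : ∀ {a} (j : Fin a) (g : Fin a → ℕ) → ∑[ i < a ] (𝟙 (does (j Finₚ.≟ i)) ℕ.* g i) ≡ g j
∑-sift {suc a} zero g =
  trans (cong₂ ℕ._+_ (ℕₚ.*-identityˡ (g zero)) (∑-zero {a} (λ _ → refl))) (ℕₚ.+-identityʳ (g zero))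
∑-sift {suc a} (suc j) g = ∑-sift j (g ∘ suc)

∑-δ : ∀ {a} (j : Fin a) → ∑[ i < a ] 𝟙 (does (j Finₚ.≟ i)) ≡ 1
∑-δ {a} j = trans (sum-cong-≗ {a} (λ i → sym (ℕₚ.*-identityʳ _))) (∑-sift j (λ _ → 1))

∑∑-δ : ∀ {a b} (j : Fin b) → ∑[ i < a ] ∑[ j′ < b ] 𝟙 (does (j Finₚ.≟ j′)) ≡ a
∑∑-δ {a} j = trans (sum-cong-≗ {a} (λ _ → ∑-δ j)) (trans (∑-const a 1) (ℕₚ.*-identityʳ a))

∑∑-row+col : ∀ {m} (r s : Fin m) →
           ∑[ i < m ] ∑[ j < m ] (𝟙 (does (r Finₚ.≟ i)) ℕ.+ 𝟙 (does (s Finₚ.≟ j))) ≡ m ℕ.+ m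
∑∑-row+col {m} r s = begin
  ∑[ i < m ] ∑[ j < m ] (𝟙 (does (r Finₚ.≟ i)) ℕ.+ 𝟙 (does (s Finₚ.≟ j)))
    ≡⟨ sum-cong-≗ {m} (λ i → ∑-distrib-+ {m} (λ _ → 𝟙 (does (r Finₚ.≟ i))) _) ⟩
  ∑[ i < m ] (∑[ j < m ] 𝟙 (does (r Finₚ.≟ i)) ℕ.+ ∑[ j < m ] 𝟙 (does (s Finₚ.≟ j)))
    ≡⟨ ∑-distrib-+ {m} _ _ ⟩
  ∑[ i < m ] ∑[ j < m ] 𝟙 (does (r Finₚ.≟ i)) ℕ.+ ∑[ i < m ] ∑[ j < m ] 𝟙 (does (s Finₚ.≟ j))
    ≡⟨ cong₂ ℕ._+_ (trans (∑-comm {m} {m} (λ i _ → 𝟙 (does (r Finₚ.≟ i)))) (∑∑-δ {m} r))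
                   (∑∑-δ {m} s) ⟩
  m ℕ.+ m ∎
  where open ≡-Reasoning

∑-↑ : ∀ a b (g : Fin (a ℕ.+ b) → ℕ) →
      ∑[ q < a ℕ.+ b ] g q ≡ ∑[ i < a ] g (i ↑ˡ b) ℕ.+ ∑[ j < b ] g (a ↑ʳ j)
∑-↑ zero    b g = refl
∑-↑ (suc a) b g = trans (cong (g zero ℕ.+_) (∑-↑ a b (g ∘ suc))) (sym (ℕₚ.+-assoc (g zero) _ _))

∑-combine : ∀ a b (g : Fin (a ℕ.* b) → ℕ) →
            ∑[ q < a ℕ.* b ] g q ≡ ∑[ i < a ] ∑[ j < b ] g (combine i j)
∑-combine zero    b g = refl
∑-combine (suc a) b g = trans (∑-↑ b (a ℕ.* b) g)
                              (cong (∑[ j < b ] g (j ↑ˡ (a ℕ.* b)) ℕ.+_) (∑-combine a b (g ∘ (b ↑ʳ_))))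

sum-map-zero : ∀ {A : Set} (L : List A) → sum (map (λ _ → 0) L) ≡ 0
sum-map-zero []      = refl
sum-map-zero (_ ∷ L) = sum-map-zero L

sum-map-filterᵇ : ∀ {A : Set} (P : A → Bool) (h : A → ℕ) (L : List A) →
                  sum (map h (filterᵇ P L)) ≡ sum (map (λ x → 𝟙 (P x) ℕ.* h x) L)
sum-map-filterᵇ P h []      = refl
sum-map-filterᵇ P h (x ∷ L) with P x
... | true  = cong₂ ℕ._+_ (sym (ℕₚ.*-identityˡ (h x))) (sum-map-filterᵇ P h L)
... | false = sum-map-filterᵇ P h L

sum-map-∑ : ∀ {A : Set} {a} (h : A → Fin a → ℕ) (L : List A) →
            sum (map (λ x → ∑[ ι < a ] h x ι) L) ≡ ∑[ ι < a ] sum (map (λ x → h x ι) L)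
sum-map-∑ {a = a} h []      = sym (∑-zero {a} (λ _ → refl))
sum-map-∑ {a = a} h (x ∷ L) = trans (cong (∑[ ι < a ] h x ι ℕ.+_) (sum-map-∑ h L))
                                    (sym (∑-distrib-+ (h x) (λ ι → sum (map (λ y → h y ι) L))))

sumℚ-map-scaled : ∀ {A : Set} (g : A → ℕ) (α : ℚ) (L : List A) →
                  sumℚ (map (λ x → ℕtoℚ (g x) * α) L) ≡ ℕtoℚ (sum (map g L)) * α
sumℚ-map-scaled g α []      = sym (ℚₚ.*-zeroˡ α)
sumℚ-map-scaled g α (x ∷ L) = begin
  ℕtoℚ (g x) * α ℚ.+ sumℚ (map (λ y → ℕtoℚ (g y) * α) L)
    ≡⟨ cong (ℕtoℚ (g x) * α ℚ.+_) (sumℚ-map-scaled g α L) ⟩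
  ℕtoℚ (g x) * α ℚ.+ ℕtoℚ (sum (map g L)) * α
    ≡⟨ sym (ℚₚ.*-distribʳ-+ α (ℕtoℚ (g x)) _) ⟩
  (ℕtoℚ (g x) ℚ.+ ℕtoℚ (sum (map g L))) * α
    ≡⟨ cong (_* α) (sym (ℕtoℚ-homo-+ (g x) _)) ⟩
  ℕtoℚ (sum (map g (x ∷ L))) * α ∎
  where open ≡-Reasoning

_≟ᵥ_ : ∀ {n} → DecidableEquality (Block n)
_≟ᵥ_ = ≡-dec Boolₚ._≟_

sum-map-allBlocks-sift : ∀ {n} (C : Block n) (g : Block n → ℕ) →
                         sum (map (λ B → 𝟙 (does (C ≟ᵥ B)) ℕ.* g B) (allBlocks n)) ≡ g C
sum-map-allBlocks-sift []      g = trans (ℕₚ.+-identityʳ _) (ℕₚ.+-identityʳ (g []))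
sum-map-allBlocks-sift {suc n} (b ∷ C) g = begin
  sum (map h (map (true ∷_) L ++ map (false ∷_) L))
    ≡⟨ cong sum (map-++ h (map (true ∷_) L) (map (false ∷_) L)) ⟩
  sum (map h (map (true ∷_) L) ++ map h (map (false ∷_) L))
    ≡⟨ sum-++ (map h (map (true ∷_) L)) _ ⟩
  sum (map h (map (true ∷_) L)) ℕ.+ sum (map h (map (false ∷_) L))
    ≡⟨ sym (cong₂ ℕ._+_ (cong sum (map-∘ L)) (cong sum (map-∘ L))) ⟩
  sum (map (h ∘ (true ∷_)) L) ℕ.+ sum (map (h ∘ (false ∷_)) L)
    ≡⟨ by-head b ⟩
  g (b ∷ C) ∎
  where
  open ≡-Reasoning
  L : List (Block n)
  L = allBlocks n
  h : Block (suc n) → ℕ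
  h B = 𝟙 (does ((b ∷ C) ≟ᵥ B)) ℕ.* g B
  by-head : ∀ b → sum (map (λ B → 𝟙 (does ((b ∷ C) ≟ᵥ (true ∷ B))) ℕ.* g (true ∷ B)) L)
                   ℕ.+ sum (map (λ B → 𝟙 (does ((b ∷ C) ≟ᵥ (false ∷ B))) ℕ.* g (false ∷ B)) L)
                 ≡ g (b ∷ C)
  by-head true  = trans (cong₂ ℕ._+_ (sum-map-allBlocks-sift C (g ∘ (true ∷_))) (sum-map-zero L))
                        (ℕₚ.+-identityʳ _)
  by-head false = cong₂ ℕ._+_ (sum-map-zero L) (sum-map-allBlocks-sift C (g ∘ (false ∷_)))

zipWith-xor-≢ : ∀ {n} {x y : Cube n} → x ≢ y → ∃ λ p → lookup (zipWith _xor_ x y) p ≡ true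
zipWith-xor-≢ {x = []}    {[]}    x≢y = ⊥-elim (x≢y refl)
zipWith-xor-≢ {x = a ∷ x} {b ∷ y} x≢y with a Boolₚ.≟ b
... | no a≢b   = zero , xor-≢ a≢b
... | yes refl with zipWith-xor-≢ (x≢y ∘ cong (a ∷_))
...   | p , x≠y-at-p = suc p , x≠y-at-p

zipWith-xor-zerosˡ : ∀ {n} (y : Vec Bool n) → zipWith _xor_ (replicate n false) y ≡ y
zipWith-xor-zerosˡ y = trans (Vecₚ.zipWith-replicate₁ _xor_ false y) (Vecₚ.map-id y)

zipWith-xor-zerosʳ : ∀ {n} (y : Vec Bool n) → zipWith _xor_ y (replicate n false) ≡ y
zipWith-xor-zerosʳ y = trans (Vecₚ.zipWith-replicate₂ _xor_ y false)
                             (trans (Vecₚ.map-cong Boolₚ.xor-identityʳ y) (Vecₚ.map-id y))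

sensitiveBlock-nonempty : ∀ {n} {f : PartialFn n} {x B} → SensitiveBlock f x B → ∃ λ p → lookup B p ≡ true
sensitiveBlock-nonempty {x = x} (y , a , b , fx≡a , fy≡b , a≢b , refl) = zipWith-xor-≢ x≢y
  where
  x≢y : x ≢ y
  x≢y refl = a≢b (just-injective (trans (sym fx≡a) fy≡b))

-- Block sensitivity and fractional packings

disjointSensitiveFamily-≤ : ∀ {n k} {f : PartialFn n} {x : Cube n}
  (class : ∀ {B} → SensitiveBlock f x B → Fin k) →
  (∀ {B C} (sB : SensitiveBlock f x B) (sC : SensitiveBlock f x C) →
     class sB ≡ class sC → ∃ λ p → lookup B p ∧ lookup C p ≡ true) →
  ∀ {m Bs} → DisjointSensitiveFamily f x m Bs → m ℕ.≤ k
disjointSensitiveFamily-≤ class meet (sensitive , disjoint) = Finₚ.injective⇒≤ injective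
  where
  injective : ∀ {j j'} → class (sensitive j) ≡ class (sensitive j') → j ≡ j'
  injective {j} {j'} same with j Finₚ.≟ j'
  ... | yes j≡j' = j≡j'
  ... | no  j≢j' with meet (sensitive j) (sensitive j') same
  ...   | p , both with trans (sym both) (disjoint j j' j≢j' p)
  ...     | ()

module _ {n a : ℕ} (F : Fin a → Block n) where

  multiplicity : Block n → ℕ
  multiplicity B = ∑[ ι < a ] 𝟙 (does (F ι ≟ᵥ B))

  multiplicity-zero-or-member : ∀ B → multiplicity B ≡ 0 ⊎ ∃ λ ι → F ι ≡ B
  multiplicity-zero-or-member B with Finₚ.any? (λ ι → F ι ≟ᵥ B)
  ... | yes member = inj₂ member
  ... | no ¬member = inj₁ (∑-zero {a} λ ι → cong 𝟙 (dec-false (F ι ≟ᵥ B) (λ e → ¬member (ι , e))))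

  multiplicity-≤-coverage : ∀ {B p} → lookup B p ≡ true →
                            multiplicity B ℕ.≤ ∑[ ι < a ] 𝟙 (lookup (F ι) p)
  multiplicity-≤-coverage {B} {p} B∋p = ∑-mono-≤ {a} indicator-≤
    where
    indicator-≤ : ∀ ι → 𝟙 (does (F ι ≟ᵥ B)) ℕ.≤ 𝟙 (lookup (F ι) p)
    indicator-≤ ι with F ι ≟ᵥ B
    ... | yes Fι≡B = ℕₚ.≤-reflexive (cong 𝟙 (sym (trans (cong (λ C → lookup C p) Fι≡B) B∋p)))
    ... | no  _    = z≤n

  sum-map-weighted-multiplicity : ∀ (g : Block n → ℕ) →
    sum (map (λ B → g B ℕ.* multiplicity B) (allBlocks n)) ≡ ∑[ ι < a ] g (F ι)
  sum-map-weighted-multiplicity g = begin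
    sum (map (λ B → g B ℕ.* multiplicity B) (allBlocks n))
      ≡⟨ cong sum (map-cong expand (allBlocks n)) ⟩
    sum (map (λ B → ∑[ ι < a ] (𝟙 (does (F ι ≟ᵥ B)) ℕ.* g B)) (allBlocks n))
      ≡⟨ sum-map-∑ (λ B ι → 𝟙 (does (F ι ≟ᵥ B)) ℕ.* g B) (allBlocks n) ⟩
    ∑[ ι < a ] sum (map (λ B → 𝟙 (does (F ι ≟ᵥ B)) ℕ.* g B) (allBlocks n))
      ≡⟨ sum-cong-≗ {a} (λ ι → sum-map-allBlocks-sift (F ι) g) ⟩
    ∑[ ι < a ] g (F ι) ∎
    where
    open ≡-Reasoning
    expand : ∀ B → g B ℕ.* multiplicity B ≡ ∑[ ι < a ] (𝟙 (does (F ι ≟ᵥ B)) ℕ.* g B)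
    expand B = trans (*-distribˡ-sum {a} (g B) _) (sum-cong-≗ {a} (λ ι → ℕₚ.*-comm (g B) _))

  sum-map-multiplicity : sum (map multiplicity (allBlocks n)) ≡ a
  sum-map-multiplicity = begin
    sum (map multiplicity (allBlocks n))
      ≡⟨ cong sum (map-cong (λ B → sym (ℕₚ.*-identityˡ (multiplicity B))) (allBlocks n)) ⟩
    sum (map (λ B → 1 ℕ.* multiplicity B) (allBlocks n))
      ≡⟨ sum-map-weighted-multiplicity (λ _ → 1) ⟩
    ∑[ ι < a ] 1
      ≡⟨ trans (∑-const a 1) (ℕₚ.*-identityʳ a) ⟩
    a ∎
    where open ≡-Reasoning

  sum-map-multiplicity-filterᵇ : ∀ (P : Block n → Bool) →
    sum (map multiplicity (filterᵇ P (allBlocks n))) ≡ ∑[ ι < a ] 𝟙 (P (F ι))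
  sum-map-multiplicity-filterᵇ P =
    trans (sum-map-filterᵇ P multiplicity (allBlocks n)) (sum-map-weighted-multiplicity (𝟙 ∘ P))

fbsAtLeast-packing : ∀ {n a} (d : ℕ) (f : PartialFn n) (x : Cube n) → InDom f x →
  (F : Fin a → Block n) → (∀ ι → SensitiveBlock f x (F ι)) →
  (∀ p → ∑[ ι < a ] 𝟙 (lookup (F ι) p) ℕ.≤ d) →
  (α : ℚ) → 0ℚ ≤ α → ℕtoℚ d * α ≤ 1ℚ → FbsAtLeast f (ℕtoℚ a * α)
fbsAtLeast-packing {n} {a} d f x x∈S F sensitive covered α α≥0 dα≤1 =
  x , x∈S , w , (w-nonNeg , w-≤1 , w-sensitive , w-covering) , ℚₚ.≤-reflexive (sym total)
  where
  instance
    α-nonNeg : NonNegative α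
    α-nonNeg = nonNegative α≥0

  -- B receives α once for every index naming it, so the load on coordinate p is
  -- α times the number of blocks of the family containing p.
  w : Block n → ℚ
  w B = ℕtoℚ (multiplicity F B) * α

  scaled-≤1 : ∀ {c} → c ℕ.≤ d → ℕtoℚ c * α ≤ 1ℚ
  scaled-≤1 c≤d = ℚₚ.≤-trans (ℚₚ.*-monoʳ-≤-nonNeg α (ℕtoℚ-mono-≤ c≤d)) dα≤1

  w-nonNeg : ∀ B → 0ℚ ≤ w B
  w-nonNeg B = ℕtoℚ-*-nonNeg (multiplicity F B) α≥0

  w-≤1 : ∀ B → w B ≤ 1ℚ
  w-≤1 B with multiplicity-zero-or-member F B
  ... | inj₁ zero-mult = scaled-≤1 (subst (ℕ._≤ d) (sym zero-mult) z≤n)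
  ... | inj₂ (ι , refl) with sensitiveBlock-nonempty (sensitive ι)
  ...   | p , Fι∋p = scaled-≤1 (ℕₚ.≤-trans (multiplicity-≤-coverage F Fι∋p) (covered p))

  w-sensitive : ∀ B → w B ≢ 0ℚ → SensitiveBlock f x B
  w-sensitive B w≢0 with multiplicity-zero-or-member F B
  ... | inj₁ zero-mult = ⊥-elim (w≢0 (trans (cong (λ c → ℕtoℚ c * α) zero-mult) (ℚₚ.*-zeroˡ α)))
  ... | inj₂ (ι , refl) = sensitive ι

  w-covering : ∀ p → sumℚ (map w (filterᵇ (λ B → lookup B p) (allBlocks n))) ≤ 1ℚ
  w-covering p = ℚₚ.≤-trans
    (ℚₚ.≤-reflexive (trans (sumℚ-map-scaled (multiplicity F) α (filterᵇ (λ B → lookup B p) (allBlocks n)))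
                           (cong (λ c → ℕtoℚ c * α) (sum-map-multiplicity-filterᵇ F (λ B → lookup B p)))))
    (scaled-≤1 (covered p))

  total : totalWeight w ≡ ℕtoℚ a * α
  total = trans (sumℚ-map-scaled (multiplicity F) α (allBlocks n))
                (cong (λ c → ℕtoℚ c * α) (sum-map-multiplicity F))

const-noSensitiveBlock : ∀ {n} b {x B : Block n} → ¬ SensitiveBlock {n} (λ _ → just b) x B
const-noSensitiveBlock b (y , a , a′ , refl , refl , a≢a′ , _) = a≢a′ refl

const-bs : ∀ {n} b → BsEq {n} (λ _ → just b) 0
const-bs {n} b = (replicate n false , (b , refl) , [] , (λ ()) , (λ ())) , ≤0
  where
  ≤0 : ∀ x → InDom (λ _ → just b) x → ∀ l Bs → DisjointSensitiveFamily (λ _ → just b) x l Bs → l ℕ.≤ 0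
  ≤0 x _ l Bs family = disjointSensitiveFamily-≤ (⊥-elim ∘ const-noSensitiveBlock b)
                                                 (λ sB → ⊥-elim (const-noSensitiveBlock b sB)) {Bs = Bs} family

const-fbs : ∀ {n} b → FbsAtLeast {n} (λ _ → just b) 0ℚ
const-fbs {n} b = fbsAtLeast-packing {a = 0} 0 _ (replicate n false) (b , refl) (λ ()) (λ ()) (λ _ → z≤n)
                                     0ℚ ℚₚ.≤-refl (ℚₚ.nonNegative⁻¹ 1ℚ)

-- The cross construction

module Crosses (k m : ℕ) where

  n : ℕ
  n = k ℕ.* (m ℕ.* m)

  Coordinates : Set
  Coordinates = Fin k × (Fin m × Fin m)

  point : Fin k → Fin m → Fin m → Fin n
  point c i j = combine c (combine i j)

  coordinates : Fin n → Coordinates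
  coordinates p = map₂ (remQuot m) (remQuot (m ℕ.* m) p)

  coordinates-point : ∀ c i j → coordinates (point c i j) ≡ (c , i , j)
  coordinates-point c i j = trans (cong (map₂ (remQuot m)) (Finₚ.remQuot-combine c (combine i j)))
                                  (cong (c ,_) (Finₚ.remQuot-combine i j))

  copy : Coordinates → Fin k
  copy = proj₁

  row col : Coordinates → Fin m
  row = proj₁ ∘ proj₂
  col = proj₂ ∘ proj₂

  liesOnCross : Coordinates → Coordinates → Bool
  liesOnCross x y = does (copy x Finₚ.≟ copy y) ∧ (does (row x Finₚ.≟ row y) ∨ does (col x Finₚ.≟ col y))

  liesOnCross-intro : ∀ x y → copy x ≡ copy y → row x ≡ row y ⊎ col x ≡ col y → liesOnCross x y ≡ true
  liesOnCross-intro x y same-copy same-line rewrite dec-true (copy x Finₚ.≟ copy y) same-copy with same-line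
  ... | inj₁ same-row rewrite dec-true (row x Finₚ.≟ row y) same-row = refl
  ... | inj₂ same-col rewrite dec-true (col x Finₚ.≟ col y) same-col = Boolₚ.∨-zeroʳ _

  liesOnCross-copy : ∀ x y → liesOnCross x y ≡ true → copy x ≡ copy y
  liesOnCross-copy x y onCross with copy x Finₚ.≟ copy y
  ... | yes same-copy = same-copy

  cross : Fin n → Block n
  cross q = tabulate (λ p → liesOnCross (coordinates p) (coordinates q))

  lookup-cross : ∀ q p → lookup (cross q) p ≡ liesOnCross (coordinates p) (coordinates q)
  lookup-cross q = lookup∘tabulate (λ p → liesOnCross (coordinates p) (coordinates q))

  cross-∋-centre : ∀ q → lookup (cross q) q ≡ true
  cross-∋-centre q = trans (lookup-cross q q) (liesOnCross-intro (coordinates q) _ refl (inj₁ refl))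

  crosses-meet : ∀ {q q′} → copy (coordinates q) ≡ copy (coordinates q′) →
                 ∃ λ p → lookup (cross q) p ∧ lookup (cross q′) p ≡ true
  crosses-meet {q} {q′} same-copy = p , cong₂ _∧_ on-q on-q′
    where
    p′ : Coordinates
    p′ = copy (coordinates q) , row (coordinates q) , col (coordinates q′)
    p : Fin n
    p = point (copy p′) (row p′) (col p′)
    on-q : lookup (cross q) p ≡ true
    on-q = trans (lookup-cross q p)
                 (trans (cong (λ r → liesOnCross r (coordinates q)) (coordinates-point _ _ _))
                        (liesOnCross-intro p′ (coordinates q) refl (inj₁ refl)))
    on-q′ : lookup (cross q′) p ≡ true
    on-q′ = trans (lookup-cross q′ p)
                  (trans (cong (λ r → liesOnCross r (coordinates q′)) (coordinates-point _ _ _))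
                         (liesOnCross-intro p′ (coordinates q′) same-copy (inj₂ refl)))

  cross-coverage : ∀ p → ∑[ q < n ] 𝟙 (lookup (cross q) p) ℕ.≤ m ℕ.+ m
  cross-coverage p = begin
    ∑[ q < n ] 𝟙 (lookup (cross q) p)
      ≡⟨ sum-cong-≗ {n} (λ q → cong 𝟙 (lookup-cross q p)) ⟩
    ∑[ q < n ] 𝟙 (liesOnCross (a , r , s) (coordinates q))
      ≡⟨ ∑-combine k (m ℕ.* m) _ ⟩
    ∑[ c < k ] ∑[ q < m ℕ.* m ] 𝟙 (liesOnCross (a , r , s) (coordinates (combine c q)))
      ≡⟨ sum-cong-≗ {k} (λ c → ∑-combine m m _) ⟩
    ∑[ c < k ] ∑[ i < m ] ∑[ j < m ] 𝟙 (liesOnCross (a , r , s) (coordinates (point c i j)))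
      ≡⟨ sum-cong-≗ {k} (λ c → sum-cong-≗ {m} (λ i → sum-cong-≗ {m} (λ j →
           cong (𝟙 ∘ liesOnCross (a , r , s)) (coordinates-point c i j)))) ⟩
    ∑[ c < k ] ∑[ i < m ] ∑[ j < m ] 𝟙 (liesOnCross (a , r , s) (c , i , j))
      ≤⟨ ∑-mono-≤ {k} (λ c → ∑-mono-≤ {m} (λ i → ∑-mono-≤ {m} (λ j →
           𝟙-∧-∨-≤ (does (a Finₚ.≟ c)) (does (r Finₚ.≟ i)) (does (s Finₚ.≟ j))))) ⟩
    ∑[ c < k ] ∑[ i < m ] ∑[ j < m ] (δ a c ℕ.* (δ r i ℕ.+ δ s j))
      ≡⟨ sum-cong-≗ {k} (λ c → sym (factor-out (δ a c))) ⟩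
    ∑[ c < k ] (δ a c ℕ.* ∑[ i < m ] ∑[ j < m ] (δ r i ℕ.+ δ s j))
      ≡⟨ ∑-sift a (λ _ → ∑[ i < m ] ∑[ j < m ] (δ r i ℕ.+ δ s j)) ⟩
    ∑[ i < m ] ∑[ j < m ] (δ r i ℕ.+ δ s j)
      ≡⟨ ∑∑-row+col r s ⟩
    m ℕ.+ m ∎
    where
    open ℕₚ.≤-Reasoning
    a : Fin k
    a = copy (coordinates p)
    r s : Fin m
    r = row (coordinates p)
    s = col (coordinates p)
    δ : ∀ {b} → Fin b → Fin b → ℕ
    δ x y = 𝟙 (does (x Finₚ.≟ y))
    factor-out : ∀ x → x ℕ.* ∑[ i < m ] ∑[ j < m ] (δ r i ℕ.+ δ s j)
                     ≡ ∑[ i < m ] ∑[ j < m ] (x ℕ.* (δ r i ℕ.+ δ s j))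
    factor-out x = trans (*-distribˡ-sum {m} x _) (sum-cong-≗ {m} (λ i → *-distribˡ-sum {m} x _))

  zeros : Cube n
  zeros = replicate n false

  IsCross : Cube n → Set
  IsCross y = ∃ λ q → y ≡ cross q

  cross-≢-zeros : ∀ q → cross q ≢ zeros
  cross-≢-zeros q cross≡zeros with trans (sym (cross-∋-centre q))
                                         (trans (cong (λ y → lookup y q) cross≡zeros) (lookup-replicate q false))
  ... | ()

  crossFn : PartialFn n
  crossFn y with Finₚ.any? (λ q → y ≟ᵥ cross q) | y ≟ᵥ zeros
  ... | yes _ | _     = just true
  ... | no  _ | yes _ = just false
  ... | no  _ | no  _ = nothing

  crossFn-cross : ∀ q → crossFn (cross q) ≡ just true
  crossFn-cross q with Finₚ.any? (λ q′ → cross q ≟ᵥ cross q′)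
  ... | yes _      = refl
  ... | no ¬cross = ⊥-elim (¬cross (q , refl))

  crossFn-zeros : crossFn zeros ≡ just false
  crossFn-zeros with Finₚ.any? (λ q → zeros ≟ᵥ cross q) | zeros ≟ᵥ zeros
  ... | yes (q , zeros≡cross) | _        = ⊥-elim (cross-≢-zeros q (sym zeros≡cross))
  ... | no _                  | yes _    = refl
  ... | no _                  | no ≢refl = ⊥-elim (≢refl refl)

  crossFn-true⁻¹ : ∀ y → crossFn y ≡ just true → IsCross y
  crossFn-true⁻¹ y fy≡1 with Finₚ.any? (λ q → y ≟ᵥ cross q) | y ≟ᵥ zeros
  crossFn-true⁻¹ y refl    | yes y-cross | _ = y-cross
  crossFn-true⁻¹ y ()      | no _        | yes _
  crossFn-true⁻¹ y ()      | no _        | no _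

  crossFn-false⁻¹ : ∀ y → crossFn y ≡ just false → y ≡ zeros
  crossFn-false⁻¹ y fy≡0 with Finₚ.any? (λ q → y ≟ᵥ cross q) | y ≟ᵥ zeros
  crossFn-false⁻¹ y ()   | yes _ | _
  crossFn-false⁻¹ y refl | no _  | yes y≡zeros = y≡zeros
  crossFn-false⁻¹ y ()   | no _  | no _

  cross-sensitive-at-zeros : ∀ q → SensitiveBlock crossFn zeros (cross q)
  cross-sensitive-at-zeros q =
    cross q , false , true , crossFn-zeros , crossFn-cross q , (λ ()) , sym (zipWith-xor-zerosˡ (cross q))

  sensitive-at-zeros : ∀ {B} → SensitiveBlock crossFn zeros B → IsCross B
  sensitive-at-zeros (y , a , b , f0≡a , fy≡b , a≢b , refl)
    with just-injective (trans (sym crossFn-zeros) f0≡a)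
  ... | refl with b
  ...   | false = ⊥-elim (a≢b refl)
  ...   | true with crossFn-true⁻¹ y fy≡b
  ...     | q , y≡cross = q , trans (zipWith-xor-zerosˡ y) y≡cross

  sensitive-at-cross : ∀ {q B} → SensitiveBlock crossFn (cross q) B → B ≡ cross q
  sensitive-at-cross {q} (y , a , b , fx≡a , fy≡b , a≢b , refl)
    with just-injective (trans (sym (crossFn-cross q)) fx≡a)
  ... | refl with b
  ...   | true  = ⊥-elim (a≢b refl)
  ...   | false rewrite crossFn-false⁻¹ y fy≡b = zipWith-xor-zerosʳ (cross q)

  crossFn-bs-≤ : 1 ℕ.≤ k → ∀ x → InDom crossFn x → ∀ l Bs → DisjointSensitiveFamily crossFn x l Bs → l ℕ.≤ k
  crossFn-bs-≤ 1≤k x (true , fx≡1) l Bs family with crossFn-true⁻¹ x fx≡1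
  ... | q , refl = ℕₚ.≤-trans (disjointSensitiveFamily-≤ {k = 1} (λ _ → zero) meet {Bs = Bs} family) 1≤k
    where
    on-centre : ∀ {B} → SensitiveBlock crossFn (cross q) B → lookup B q ≡ true
    on-centre sB = trans (cong (λ B → lookup B q) (sensitive-at-cross sB)) (cross-∋-centre q)
    meet : ∀ {B C} (sB : SensitiveBlock crossFn (cross q) B) (sC : SensitiveBlock crossFn (cross q) C) →
           zero ≡ zero → ∃ λ p → lookup B p ∧ lookup C p ≡ true
    meet sB sC _ = q , cong₂ _∧_ (on-centre sB) (on-centre sC)
  crossFn-bs-≤ _ x (false , fx≡0) l Bs family with crossFn-false⁻¹ x fx≡0
  ... | refl = disjointSensitiveFamily-≤ centre-copy meet {Bs = Bs} family
    where
    centre-copy : ∀ {B} → SensitiveBlock crossFn zeros B → Fin k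
    centre-copy sB = copy (coordinates (proj₁ (sensitive-at-zeros sB)))
    meet : ∀ {B C} (sB : SensitiveBlock crossFn zeros B) (sC : SensitiveBlock crossFn zeros C) →
           centre-copy sB ≡ centre-copy sC → ∃ λ p → lookup B p ∧ lookup C p ≡ true
    meet sB sC same-copy with sensitive-at-zeros sB | sensitive-at-zeros sC
    ... | q , refl | q′ , refl = crosses-meet same-copy

  crossFn-bs-≥ : Fin m → Σ (Vec (Block n) k) λ Bs → DisjointSensitiveFamily crossFn zeros k Bs
  crossFn-bs-≥ z = tabulate centred , sensitive , disjoint
    where
    centred : Fin k → Block n
    centred c = cross (point c z z)
    copy-of : ∀ {c p} → lookup (centred c) p ≡ true → copy (coordinates p) ≡ c
    copy-of {c} {p} on = trans (liesOnCross-copy (coordinates p) _ (trans (sym (lookup-cross _ p)) on))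
                               (cong copy (coordinates-point c z z))
    sensitive : ∀ c → SensitiveBlock crossFn zeros (lookup (tabulate centred) c)
    sensitive c rewrite lookup∘tabulate centred c = cross-sensitive-at-zeros (point c z z)
    disjoint : ∀ c c′ → c ≢ c′ → Disjoint (lookup (tabulate centred) c) (lookup (tabulate centred) c′)
    disjoint c c′ c≢c′ p rewrite lookup∘tabulate centred c | lookup∘tabulate centred c′ =
      ∧-≡-false λ on-c on-c′ → c≢c′ (trans (sym (copy-of on-c)) (copy-of on-c′))

  crossFn-bs : 1 ℕ.≤ k → Fin m → BsEq crossFn k
  crossFn-bs 1≤k z = (zeros , (false , crossFn-zeros) , crossFn-bs-≥ z) , crossFn-bs-≤ 1≤k

  crossFn-fbs : ∀ α → 0ℚ ≤ α → ℕtoℚ (m ℕ.+ m) * α ≤ 1ℚ → FbsAtLeast crossFn (ℕtoℚ n * α)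
  crossFn-fbs = fbsAtLeast-packing (m ℕ.+ m) crossFn zeros (false , crossFn-zeros)
                                   cross cross-sensitive-at-zeros cross-coverage

-- Choosing the parameters

x+x≡1⇒x≡½ : ∀ x → x ℚ.+ x ≡ 1ℚ → x ≡ ½
x+x≡1⇒x≡½ x x+x≡1 = begin
  x              ≡⟨ solve 1 (λ y → y := con ½ :* (y :+ y)) refl x ⟩
  ½ * (x ℚ.+ x)  ≡⟨ cong (½ *_) x+x≡1 ⟩
  ½ * 1ℚ         ≡⟨ ℚₚ.*-identityʳ ½ ⟩
  ½              ∎
  where open ≡-Reasoning

packing-value-square : ∀ k m α → ℕtoℚ (m ℕ.+ m) * α ≡ 1ℚ →
  (½ * ½) * (ℕtoℚ (k ℕ.* (m ℕ.* m)) * ℕtoℚ k)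
    ≡ (ℕtoℚ (k ℕ.* (m ℕ.* m)) * α) * (ℕtoℚ (k ℕ.* (m ℕ.* m)) * α)
packing-value-square k m α 2mα≡1 rewrite ℕtoℚ-homo-* k (m ℕ.* m) | ℕtoℚ-homo-* m m = begin
  (½ * ½) * ((K * (M * M)) * K)
    ≡⟨ solve 3 (λ h x y → (h :* h) :* ((x :* (y :* y)) :* x) := (x :* y :* h) :* (x :* y :* h)) refl ½ K M ⟩
  (K * M * ½) * (K * M * ½)
    ≡⟨ cong (λ h → (K * M * h) * (K * M * h)) (sym mα≡½) ⟩
  (K * M * (M * α)) * (K * M * (M * α))
    ≡⟨ cong (λ t → t * t) (solve 3 (λ x y a → x :* y :* (y :* a) := x :* (y :* y) :* a) refl K M α) ⟩
  (K * (M * M) * α) * (K * (M * M) * α)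
    ∎
  where
  open ≡-Reasoning
  K M : ℚ
  K = ℕtoℚ k
  M = ℕtoℚ m
  mα≡½ : M * α ≡ ½
  mα≡½ = x+x≡1⇒x≡½ (M * α) (begin
    M * α ℚ.+ M * α      ≡⟨ sym (ℚₚ.*-distribʳ-+ α M M) ⟩
    (M ℚ.+ M) * α        ≡⟨ cong (_* α) (sym (ℕtoℚ-homo-+ m m)) ⟩
    ℕtoℚ (m ℕ.+ m) * α   ≡⟨ 2mα≡1 ⟩
    1ℚ                   ∎)

FbsGap : ℚ → ℕ → ℕ → Set
FbsGap c k N = Σ ℕ λ n → (n ≥ N) × Σ (PartialFn n) λ f →
               BsEq f k × Σ ℚ λ t → (0ℚ ≤ t) × FbsAtLeast f t × ((c * c) * (ℕtoℚ n * ℕtoℚ k) ≤ t * t)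

fbsGap-½ : ∀ k N → FbsGap ½ k N
fbsGap-½ zero N =
  N , ℕₚ.≤-refl , (λ _ → just false) , const-bs false ,
  0ℚ , ℚₚ.≤-refl , const-fbs false ,
  ℚₚ.≤-reflexive (trans (cong (½ * ½ *_) (ℚₚ.*-zeroʳ (ℕtoℚ N))) (ℚₚ.*-zeroʳ (½ * ½)))
fbsGap-½ (suc k′) N =
  n , N≤n , crossFn , crossFn-bs (s≤s z≤n) zero ,
  ℕtoℚ n * α , ℕtoℚ-*-nonNeg n α≥0 , crossFn-fbs α α≥0 (ℚₚ.≤-reflexive 2mα≡1) ,
  ℚₚ.≤-reflexive (packing-value-square k m α 2mα≡1)
  where
  k m : ℕ
  k = suc k′
  m = suc N
  open Crosses k m
  instance
    2m-positive : Positive (ℕtoℚ (m ℕ.+ m))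
    2m-positive = ℚₚ.normalize-pos (m ℕ.+ m) 1
    2m-nonZero : ℚ.NonZero (ℕtoℚ (m ℕ.+ m))
    2m-nonZero = ℚₚ.pos⇒nonZero (ℕtoℚ (m ℕ.+ m))
  α : ℚ
  α = 1/ ℕtoℚ (m ℕ.+ m)
  α≥0 : 0ℚ ≤ α
  α≥0 = ℚₚ.nonNegative⁻¹ α {{ℚₚ.pos⇒nonNeg α {{ℚₚ.1/pos⇒pos (ℕtoℚ (m ℕ.+ m))}}}}
  2mα≡1 : ℕtoℚ (m ℕ.+ m) * α ≡ 1ℚ
  2mα≡1 = ℚₚ.*-inverseʳ (ℕtoℚ (m ℕ.+ m))
  N≤n : n ≥ N
  N≤n = ℕₚ.≤-trans (ℕₚ.n≤1+n N) (ℕₚ.≤-trans (ℕₚ.m≤m*n m m) (ℕₚ.m≤n*m (m ℕ.* m) k))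

theorem5 : Σ ℚ λ c → (0ℚ < c) ×
             (∀ (k N : ℕ) → Σ ℕ λ n → (n ≥ N) × Σ (PartialFn n) λ f →
               BsEq f k × Σ ℚ λ t → (0ℚ ≤ t) × FbsAtLeast f t × ((c * c) * (ℕtoℚ n * ℕtoℚ k) ≤ t * t))
theorem5 = ½ , ℚₚ.positive⁻¹ ½ , fbsGap-½
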